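{- Let $m\geq 2$ and let $\mathbf{P}=(X_1,\ldots,X_m;\preceq)$ be an $m$-partite poset. Then \[ \dim(\mathbf{P})\leq \left\lfloor \frac{(m-1)(m+3)}{4}\right\rfloor B(\mathbf{P}), \] where $B(\mathbf{P})=\max_{1\le i<j\le m}\dim(\mathbf{P}_{i,j})$.
   Context: All posets are finite. The order dimension $\dim(\mathbf{Q})$ of a poset $\mathbf{Q}=(X,\preceq)$ is the least number $d$ of linear extensions $\preceq_1,\ldots,\preceq_d$ of $\preceq$ such that for all $x,y\in X$: $x\preceq y$ iff $x\preceq_i y$ for all $i\in[d]$. For an integer $m\geq 2$ and disjoint nonempty sets $X_1,\ldots,X_m$, $\mathbf{P}=(X_1,\ldots,X_m;\preceq)$ is an $m$-partite poset if $\preceq$ is a partial order on $X=X_1\cup\cdots\cup X_m$ such that (1) each $X_i$ is an antichain, and (2) $x\prec y$ implies $x\in X_i$, $y\in X_j$ with $i<j$. Its dimension is that of the poset $(X,\preceq)$. For $i<j$, $\mathbf{P}_{i,j}$ denotes the sub-poset of $\mathbf{P}$ induced on $X_i\cup X_j$. -}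

module Defs where

open import Data.Nat using (ℕ; _≤_)
open import Level using (0ℓ)
open import Data.Fin using (Fin; _<_)
open import Data.Product using (Σ; ∃; _×_)
open import Data.Sum using (_⊎_)
open import Function.Bundles using (_⇔_)
open import Relation.Binary.Core using (Rel)
open import Relation.Binary.Structures using (IsPartialOrder)
open import Relation.Binary.PropositionalEquality using (_≡_; _≢_)

-- Induced sub-posets are handled by a
-- predicate S : Fin n → Set selecting the elements of the sub-poset.

record IsLinExtOn {n : ℕ} (S : Fin n → Set) (R L : Rel (Fin n) 0ℓ) : Set where
  field
    refl    : ∀ x → S x → L x x
    antisym : ∀ x y → S x → S y → L x y → L y x → x ≡ y
    trans   : ∀ x y z → S x → S y → S z → L x y → L y z → L x z
    total   : ∀ x y → S x → S y → (L x y ⊎ L y x)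
    extends : ∀ x y → S x → S y → R x y → L x y

record IsRealizerOn {n : ℕ} (S : Fin n → Set) (R : Rel (Fin n) 0ℓ)
                    (d : ℕ) (Ls : Fin d → Rel (Fin n) 0ℓ) : Set where
  field
    linExt    : ∀ k → IsLinExtOn S R (Ls k)
    intersect : ∀ x y → S x → S y → (R x y ⇔ (∀ k → Ls k x y))

DimLE : {n : ℕ} → (S : Fin n → Set) → Rel (Fin n) 0ℓ → ℕ → Set₁
DimLE {n} S R d = Σ ℕ λ k → k ≤ d × Σ (Fin k → Rel (Fin n) 0ℓ) λ Ls → IsRealizerOn S R k Ls

-- Elements of X_i ∪ X_j, where part x = i means x ∈ X_i.
InParts : {m n : ℕ} → (Fin n → Fin m) → Fin m → Fin m → Fin n → Set
InParts part i j x = part x ≡ i ⊎ part x ≡ j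

record IsMPartite (m n : ℕ) (part : Fin n → Fin m) (R : Rel (Fin n) 0ℓ) : Set where
  field
    isPartialOrder : IsPartialOrder _≡_ R
    nonempty       : ∀ i → Σ (Fin n) λ x → part x ≡ i
    antichain      : ∀ x y → part x ≡ part y → R x y → x ≡ y
    upward         : ∀ x y → R x y → x ≢ y → part x < part y

-- Let p = ⌊(m - 1)/2⌋ and call a pair of layers a < b with a ≤ p ≤ b a column;
-- there are p(m - p) + (m - p - 1) = ⌊(m - 1)(m + 3)/4⌋ columns.  A column cuts the
-- layers into three zones (below a, from a to b, above b), and each zone contains
-- a layer pair: (m - 1 - b , a - 1), (a , b) and (b + 1 , m - 1 - a) respectively.
-- Gluing, for each k < B, the k-th linear extensions of realizers of these three
-- pairs along the zones gives B linear extensions of P per column.  Every pair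
-- i < j of layers is served by some column, so an incomparable pair x, y in layers
-- i, j, reversed by an extension of P_{i,j}, is reversed by one of the glued ones.
module Submission where

module MultipartiteDimension where

  open import Defs
  open import Level using (0ℓ)
  open import Data.Empty using (⊥)
  open import Data.Fin using (Fin; toℕ; fromℕ<; inject≤; splitAt; remQuot; combine; _↑ˡ_; _↑ʳ_)
    renaming (_<_ to _<ᶠ_)
  open import Data.Fin.Properties
    using (toℕ-injective; toℕ-fromℕ<; toℕ-inject≤; toℕ<n; <-cmp; all?; any?; ¬∀⟶∃¬;
           splitAt-↑ˡ; splitAt-↑ʳ; remQuot-combine)
    renaming (_≟_ to _≟ᶠ_)
  open import Data.Fin.Subset using (Subset; _∈_; _⊆_; ∣_∣)
  open import Data.Fin.Subset.Properties using (p⊆q⇒∣p∣≤∣q∣; p⊂q⇒∣p∣<∣q∣)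
  open import Data.Nat
    using (ℕ; zero; suc; pred; _≤_; _<_; _+_; _*_; _∸_; _/_; _≤?_; _<?_; z≤n; s≤s; >-nonZero)
    renaming (_≟_ to _≟ℕ_)
  open import Data.Nat.DivMod using (m*n/n≡m; /-monoˡ-≤)
  open import Data.Nat.Properties
    using (≤-refl; ≤-reflexive; ≤-trans; <-trans; <-irrefl; ≤-<-trans; <-≤-trans; <⇒≤; ≤⇒≯; ≮⇒≥; ≰⇒>;
           ≤∧≮⇒≡; m≤n⇒m<n∨m≡n; ≤-pred; <⇒≤pred; n≤1+n; n<1+n; m≤m+n; pred[n]≤n; suc-pred;
           +-suc; +-mono-≤; +-monoˡ-≤; +-monoʳ-<; m∸n≤m; m∸[m∸n]≡n; m+[n∸m]≡n; m+n∸n≡m;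
           m+n≤o⇒m≤o∸n; m<n+o⇒m∸n<o; ∸-monoˡ-<; <-isStrictTotalOrder)
  open import Data.Nat.Tactic.RingSolver using (solve-∀)
  open import Data.Product using (∃; ∃₂; ∃-syntax; _×_; _,_; proj₁; proj₂)
  open import Data.Sum using (_⊎_; inj₁; inj₂; [_,_]′)
  open import Data.Unit using (⊤)
  open import Data.Vec using (Vec; []; _∷_; last; tabulate)
  open import Data.Vec.Properties using (lookup∘tabulate; lookup⇒[]=; []=⇒lookup)
  open import Data.Vec.Relation.Binary.Lex.Core using (this; next)
  open import Data.Vec.Relation.Binary.Lex.Strict using (Lex-≤; ≤-isTotalOrder)
  open import Data.Vec.Relation.Binary.Pointwise.Inductive using (Pointwise-≡⇒≡)
  open import Function using (_∘_)
  open import Function.Bundles using (mk⇔; Equivalence)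
  open import Relation.Binary.Core using (Rel)
  open import Relation.Binary.Definitions using (tri<; tri≈; tri>)
  open import Relation.Binary.Structures using (IsPartialOrder; IsTotalOrder)
  open import Relation.Binary.PropositionalEquality
    using (_≡_; _≢_; refl; sym; trans; cong; cong₂; subst; subst₂; module ≡-Reasoning)
  open import Relation.Nullary using (Dec; yes; no; ¬_; does; contradiction)
  open import Relation.Nullary.Decidable using (dec-true; map′; _×-dec_; _⊎-dec_)
  open import Relation.Unary using (Pred; Decidable)

  open ≡-Reasoning

  module _ {n : ℕ} {S : Fin n → Set} {R L : Rel (Fin n) 0ℓ} (lin : IsLinExtOn S R L) where
    private module L = IsLinExtOn lin

    isLinExtOn-decidable : ∀ x y → S x → S y → Dec (L x y)
    isLinExtOn-decidable x y sx sy with L.total x y sx sy | x ≟ᶠ y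
    ... | inj₁ xy | _        = yes xy
    ... | inj₂ yx | yes refl = yes yx
    ... | inj₂ yx | no x≢y   = no (λ xy → x≢y (L.antisym x y sx sy xy yx))

    isLinExtOn-restrict : {S′ : Fin n → Set} → (∀ x → S′ x → S x) → IsLinExtOn S′ R L
    isLinExtOn-restrict S′⊆S = record
      { refl    = λ x sx → L.refl x (S′⊆S x sx)
      ; antisym = λ x y sx sy → L.antisym x y (S′⊆S x sx) (S′⊆S y sy)
      ; trans   = λ x y z sx sy sz → L.trans x y z (S′⊆S x sx) (S′⊆S y sy) (S′⊆S z sz)
      ; total   = λ x y sx sy → L.total x y (S′⊆S x sx) (S′⊆S y sy)
      ; extends = λ x y sx sy → L.extends x y (S′⊆S x sx) (S′⊆S y sy)
      }

  isLinExtOn-∅ : {n : ℕ} {R L : Rel (Fin n) 0ℓ} → IsLinExtOn (λ _ → ⊥) R L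
  isLinExtOn-∅ = record
    { refl = λ _ () ; antisym = λ _ _ () ; trans = λ _ _ _ () ; total = λ _ _ () ; extends = λ _ _ () }

  _≤ₗₑₓ_ : {k : ℕ} → Rel (Vec ℕ k) 0ℓ
  _≤ₗₑₓ_ = Lex-≤ _≡_ _<_

  module ≤ₗₑₓ {k : ℕ} = IsTotalOrder (≤-isTotalOrder <-isStrictTotalOrder {k})

  lex-∷ : ∀ {k a b} {as bs : Vec ℕ k} → a ≤ b → (a ≡ b → as ≤ₗₑₓ bs) → (a ∷ as) ≤ₗₑₓ (b ∷ bs)
  lex-∷ a≤b as≤bs with m≤n⇒m<n∨m≡n a≤b
  ... | inj₁ a<b  = this a<b refl
  ... | inj₂ refl = next refl (as≤bs refl)

  module _ {n k : ℕ} {S : Fin n → Set} {R : Rel (Fin n) 0ℓ} (key : Fin n → Vec ℕ k)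
           (key-injective : ∀ {x y} → key x ≡ key y → x ≡ y)
           (key-mono : ∀ {x y} → R x y → key x ≤ₗₑₓ key y) where

    keyOrder-isLinExtOn : IsLinExtOn S R (λ x y → key x ≤ₗₑₓ key y)
    keyOrder-isLinExtOn = record
      { refl    = λ x _ → ≤ₗₑₓ.refl
      ; antisym = λ _ _ _ _ xy yx → key-injective (Pointwise-≡⇒≡ (≤ₗₑₓ.antisym xy yx))
      ; trans   = λ _ _ _ _ _ _ → ≤ₗₑₓ.trans
      ; total   = λ x y _ _ → ≤ₗₑₓ.total (key x) (key y)
      ; extends = λ _ _ _ _ → key-mono
      }

  module _ {n : ℕ} {S : Fin n → Set} {R : Rel (Fin n) 0ℓ} (R-refl : ∀ x → S x → R x x)
           (R? : ∀ x y → Dec (R x y)) {d : ℕ} {Ls : Fin d → Rel (Fin n) 0ℓ}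
           (lin : ∀ k → IsLinExtOn S R (Ls k))
           (reverse : ∀ x y → S x → S y → ¬ R x y → ∃ λ k → Ls k y x) where

    isRealizerOn-fromReversals : IsRealizerOn S R d Ls
    isRealizerOn-fromReversals = record
      { linExt    = lin
      ; intersect = λ x y sx sy → mk⇔ (λ xy k → IsLinExtOn.extends (lin k) x y sx sy xy) (sound x y sx sy)
      }
      where
      sound : ∀ x y → S x → S y → (∀ k → Ls k x y) → R x y
      sound x y sx sy xy with R? x y
      ... | yes r = r
      ... | no ¬r with reverse x y sx sy ¬r
      ...   | k , yx with IsLinExtOn.antisym (lin k) x y sx sy (xy k) yx
      ...     | refl = contradiction (R-refl x sx) ¬r

  module _ {n : ℕ} {S : Fin n → Set} {R : Rel (Fin n) 0ℓ} {d : ℕ} {Ls : Fin d → Rel (Fin n) 0ℓ}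
           (realizer : IsRealizerOn S R d Ls) where
    open IsRealizerOn realizer

    isRealizerOn-decidable : ∀ x y → S x → S y → Dec (R x y)
    isRealizerOn-decidable x y sx sy with all? (λ k → isLinExtOn-decidable (linExt k) x y sx sy)
    ... | yes all = yes (Equivalence.from (intersect x y sx sy) all)
    ... | no ¬all = no (λ r → ¬all (Equivalence.to (intersect x y sx sy) r))

    isRealizerOn-reverses : ∀ x y → S x → S y → ¬ R x y → ∃ λ k → Ls k y x
    isRealizerOn-reverses x y sx sy ¬r with ¬∀⟶∃¬ d _ (λ k → isLinExtOn-decidable (linExt k) x y sx sy)
                                                (¬r ∘ Equivalence.from (intersect x y sx sy))
    ... | k , ¬xy with IsLinExtOn.total (linExt k) x y sx sy
    ...   | inj₁ xy = contradiction xy ¬xy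
    ...   | inj₂ yx = k , yx

  toSubset : {n : ℕ} {P : Pred (Fin n) 0ℓ} → Decidable P → Subset n
  toSubset P? = tabulate (does ∘ P?)

  module _ {n : ℕ} {P : Pred (Fin n) 0ℓ} (P? : Decidable P) where

    ∈-toSubset⁺ : ∀ {x} → P x → x ∈ toSubset P?
    ∈-toSubset⁺ {x} px = lookup⇒[]= x _ (trans (lookup∘tabulate _ x) (dec-true (P? x) px))

    ∈-toSubset⁻ : ∀ {x} → x ∈ toSubset P? → P x
    ∈-toSubset⁻ {x} x∈ with P? x | trans (sym (lookup∘tabulate (does ∘ P?) x)) ([]=⇒lookup x∈)
    ... | yes px | _  = px
    ... | no _   | ()

  toSubset-⊆ : {n : ℕ} {P Q : Pred (Fin n) 0ℓ} (P? : Decidable P) (Q? : Decidable Q)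
             → (∀ {x} → P x → Q x) → toSubset P? ⊆ toSubset Q?
  toSubset-⊆ P? Q? P⇒Q = ∈-toSubset⁺ Q? ∘ P⇒Q ∘ ∈-toSubset⁻ P?

  -- The rank of y in
  -- block c counts the elements of S c lying L c-below some element of S c that is
  -- R-below y; it is R-monotone and strictly increasing along L c on S c, so the
  -- glued order extends R and every L c.
  module Gluing {n : ℕ} {R : Rel (Fin n) 0ℓ} (R-isPartialOrder : IsPartialOrder _≡_ R)
    (R? : ∀ x y → Dec (R x y))
    (height : Fin n → ℕ) (height-strict : ∀ {x y} → R x y → x ≢ y → height x < height y)
    (block : Fin n → ℕ) (block-mono : ∀ {x y} → R x y → block x ≤ block y)
    (S : ℕ → Fin n → Set) (S? : ∀ c → Decidable (S c)) (S⊆block : ∀ {c x} → S c x → block x ≡ c)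
    (L : ℕ → Rel (Fin n) 0ℓ) (L-isLinExtOn : ∀ c → IsLinExtOn (S c) R (L c)) where

    module R = IsPartialOrder R-isPartialOrder
    module L c = IsLinExtOn (L-isLinExtOn c)

    Shadow : ℕ → Fin n → Fin n → Set
    Shadow c y u = S c u × ∃[ w ] (S c w × R w y × L c u w)

    Shadow? : ∀ c y → Decidable (Shadow c y)
    Shadow? c y u with S? c u
    ... | no ¬su = no (¬su ∘ proj₁)
    ... | yes su = map′ (su ,_) proj₂ (any? witness?)
      where
      witness? : ∀ w → Dec (S c w × R w y × L c u w)
      witness? w with S? c w
      ... | no ¬sw = no (¬sw ∘ proj₁)
      ... | yes sw = yes sw ×-dec (R? w y ×-dec isLinExtOn-decidable (L-isLinExtOn c) u w su sw)

    rank : ℕ → Fin n → ℕ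
    rank c y = ∣ toSubset (Shadow? c y) ∣

    rank-mono : ∀ c {y y′} → R y y′ → rank c y ≤ rank c y′
    rank-mono c {y} {y′} yy′ = p⊆q⇒∣p∣≤∣q∣ (toSubset-⊆ (Shadow? c y) (Shadow? c y′) widen)
      where
      widen : ∀ {u} → Shadow c y u → Shadow c y′ u
      widen (su , w , sw , wy , uw) = su , w , sw , R.trans wy yy′ , uw

    rank-strict : ∀ c {u v} → S c u → S c v → L c u v → u ≢ v → rank c u < rank c v
    rank-strict c {u} {v} su sv uv u≢v =
      p⊂q⇒∣p∣<∣q∣ ( toSubset-⊆ (Shadow? c u) (Shadow? c v) widen
                  , v , ∈-toSubset⁺ (Shadow? c v) (sv , v , sv , R.refl , L.refl c v sv)
                  , v∉ ∘ ∈-toSubset⁻ (Shadow? c u) )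
      where
      below-u : ∀ {z} → Shadow c u z → L c z u
      below-u (sz , w , sw , wu , zw) = L.trans c _ w u sz sw su zw (L.extends c w u sw su wu)
      widen : ∀ {z} → Shadow c u z → Shadow c v z
      widen {z} sh = proj₁ sh , v , sv , R.refl , L.trans c z u v (proj₁ sh) su sv (below-u sh) uv
      v∉ : ¬ Shadow c u v
      v∉ sh = u≢v (L.antisym c u v su sv uv (below-u sh))

    key : Fin n → Vec ℕ 4
    key x = block x ∷ rank (block x) x ∷ height x ∷ toℕ x ∷ []

    key-injective : ∀ {x y} → key x ≡ key y → x ≡ y
    key-injective = toℕ-injective ∘ cong last

    key-mono : ∀ {x y} → R x y → key x ≤ₗₑₓ key y
    key-mono {x} {y} xy with x ≟ᶠ y
    ... | yes refl = ≤ₗₑₓ.refl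
    ... | no x≢y   = lex-∷ (block-mono xy) λ bx≡by →
                     lex-∷ (subst (λ c → rank (block x) x ≤ rank c y) bx≡by (rank-mono (block x) xy)) λ _ →
                     this (height-strict xy x≢y) refl

    glued : Rel (Fin n) 0ℓ
    glued x y = key x ≤ₗₑₓ key y

    glued-isLinExtOn : ∀ {T} → IsLinExtOn T R glued
    glued-isLinExtOn = keyOrder-isLinExtOn key key-injective key-mono

    glued-extends : ∀ c {u v} → S c u → S c v → L c u v → glued u v
    glued-extends c {u} {v} su sv uv with u ≟ᶠ v
    ... | yes refl = ≤ₗₑₓ.refl
    ... | no u≢v rewrite S⊆block su | S⊆block sv = next refl (this (rank-strict c su sv uv u≢v) refl)

  record PartialLinExt {n : ℕ} (R : Rel (Fin n) 0ℓ) : Set₁ where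
    field
      support    : Fin n → Set
      support?   : Decidable support
      order      : Rel (Fin n) 0ℓ
      isLinExtOn : IsLinExtOn support R order

  open PartialLinExt

  Reverses : {n : ℕ} {R : Rel (Fin n) 0ℓ} → PartialLinExt R → Fin n → Fin n → Set
  Reverses E x y = support E x × support E y × order E y x

  emptyLinExt : {n : ℕ} {R : Rel (Fin n) 0ℓ} → PartialLinExt R
  emptyLinExt = record
    { support = λ _ → ⊥ ; support? = λ _ → no λ () ; order = λ _ _ → ⊥ ; isLinExtOn = isLinExtOn-∅ }

  module _ {n : ℕ} {S : Fin n → Set} (S? : Decidable S) {R : Rel (Fin n) 0ℓ} {B : ℕ} where

    padded : DimLE S R B → Fin B → PartialLinExt R
    padded (d , _ , Ls , realizer) k with toℕ k <? d
    ... | yes k<d = record { support = S ; support? = S? ; order = Ls (fromℕ< k<d)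
                           ; isLinExtOn = IsRealizerOn.linExt realizer (fromℕ< k<d) }
    ... | no _    = emptyLinExt

    padded-reverses : (D : DimLE S R B) → ∀ {x y} → S x → S y → ¬ R x y → ∃ λ k → Reverses (padded D k) x y
    padded-reverses (d , d≤B , Ls , realizer) {x} {y} sx sy ¬xy
      with isRealizerOn-reverses realizer x y sx sy ¬xy
    ... | k , yx = inject≤ k d≤B , reverses
      where
      reverses : Reverses (padded (d , d≤B , Ls , realizer) (inject≤ k d≤B)) x y
      reverses with toℕ (inject≤ k d≤B) <? d
      ... | yes k<d = sx , sy , subst (λ k′ → Ls k′ y x) (sym k≡k) yx
        where
        k≡k : fromℕ< k<d ≡ k
        k≡k = toℕ-injective (trans (toℕ-fromℕ< k<d) (toℕ-inject≤ k d≤B))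
      ... | no k≮d  = contradiction (subst (_< d) (sym (toℕ-inject≤ k d≤B)) (toℕ<n k)) k≮d

  threshold : ℕ → ℕ → ℕ
  threshold a t with a ≤? t
  ... | yes _ = 1
  ... | no _  = 0

  threshold-mono : ∀ a {t t′} → t ≤ t′ → threshold a t ≤ threshold a t′
  threshold-mono a {t} {t′} t≤t′ with a ≤? t | a ≤? t′
  ... | yes _   | yes _    = ≤-refl
  ... | no _    | _        = z≤n
  ... | yes a≤t | no a≰t′ = contradiction (≤-trans a≤t t≤t′) a≰t′

  threshold-below : ∀ {a t} → t < a → threshold a t ≡ 0
  threshold-below {a} {t} t<a with a ≤? t
  ... | yes a≤t = contradiction t<a (≤⇒≯ a≤t)
  ... | no _    = refl

  threshold-above : ∀ {a t} → a ≤ t → threshold a t ≡ 1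
  threshold-above {a} {t} a≤t with a ≤? t
  ... | yes _   = refl
  ... | no a≰t = contradiction a≤t a≰t

  -- zone a b t is 0, 1 or 2 according as t < a, a ≤ t ≤ b or b < t (when a ≤ b + 1).
  zone : ℕ → ℕ → ℕ → ℕ
  zone a b t = threshold a t + threshold (suc b) t

  zone-mono : ∀ a b {t t′} → t ≤ t′ → zone a b t ≤ zone a b t′
  zone-mono a b t≤t′ = +-mono-≤ (threshold-mono a t≤t′) (threshold-mono (suc b) t≤t′)

  zone-low : ∀ {a b t} → t < a → t ≤ b → zone a b t ≡ 0
  zone-low t<a t≤b rewrite threshold-below t<a | threshold-below (s≤s t≤b) = refl

  zone-middle : ∀ {a b t} → a ≤ t → t ≤ b → zone a b t ≡ 1
  zone-middle a≤t t≤b rewrite threshold-above a≤t | threshold-below (s≤s t≤b) = refl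

  zone-high : ∀ {a b t} → a ≤ t → b < t → zone a b t ≡ 2
  zone-high a≤t b<t rewrite threshold-above a≤t | threshold-above b<t = refl

  mirror : ℕ → ℕ → ℕ
  mirror m t = pred m ∸ t

  mirror-involutive : ∀ {m t} → t < m → mirror m (mirror m t) ≡ t
  mirror-involutive {suc m} (s≤s t≤m) = m∸[m∸n]≡n t≤m

  mirror<m : ∀ {m} t → 0 < m → mirror m t < m
  mirror<m {suc m} t _ = s≤s (m∸n≤m m t)

  p<mirror : ∀ {m p i} → i < p → suc (p + p) ≤ m → p < mirror m i
  p<mirror {suc m} {p} i<p (s≤s 2p≤m) = m+n≤o⇒m≤o∸n (suc p) (≤-trans (+-monoʳ-< p i<p) 2p≤m)

  mirror<p : ∀ {m p j} → suc (suc p) ≤ j → j < m → m ≤ suc (suc (p + p)) → mirror m j < p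
  mirror<p {suc m} {zero}  2≤j j<m m≤2 =
    contradiction (≤-trans 2≤j (≤-pred (≤-trans j<m m≤2))) λ { (s≤s ()) }
  mirror<p {suc m} {suc q} p+2≤j _ m≤2p+2 = m<n+o⇒m∸n<o m _ (≤-trans m≤2p+2 (+-monoˡ-≤ (suc q) p+2≤j))

  data IsMiddle : ℕ → ℕ → Set where
    odd  : ∀ p → IsMiddle (suc (p + p)) p
    even : ∀ p → IsMiddle (suc (suc (p + p))) p

  middle : ∀ m → 0 < m → ∃ (IsMiddle m)
  middle (suc zero)          _ = 0 , odd 0
  middle (suc (suc zero))    _ = 0 , even 0
  middle (suc (suc (suc m))) _ with middle (suc m) (s≤s z≤n)
  ... | p , odd .p  = suc p , subst (λ t → IsMiddle (suc (suc t)) (suc p)) (+-suc p p) (odd (suc p))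
  ... | p , even .p = suc p , subst (λ t → IsMiddle (suc (suc (suc t))) (suc p)) (+-suc p p) (even (suc p))

  isMiddle⇒2p+1≤m : ∀ {m p} → IsMiddle m p → suc (p + p) ≤ m
  isMiddle⇒2p+1≤m (odd _)  = ≤-refl
  isMiddle⇒2p+1≤m (even _) = n≤1+n _

  isMiddle⇒m≤2p+2 : ∀ {m p} → IsMiddle m p → m ≤ suc (suc (p + p))
  isMiddle⇒m≤2p+2 (odd _)  = n≤1+n _
  isMiddle⇒m≤2p+2 (even _) = ≤-refl

  columnCount : ℕ → ℕ → ℕ
  columnCount m p = p * (m ∸ p) + (m ∸ suc p)

  ≤/4 : ∀ {x y} → x * 4 ≤ y → x ≤ y / 4
  ≤/4 {x} {y} x*4≤y = subst (_≤ y / 4) (m*n/n≡m x 4) (/-monoˡ-≤ 4 x*4≤y)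

  columnCount-bound : ∀ {m p} → IsMiddle m p → columnCount m p ≤ (m ∸ 1) * (m + 3) / 4
  columnCount-bound (odd p) rewrite m+n∸n≡m (suc p) p | m+n∸n≡m p p =
    ≤/4 (≤-reflexive (identity p))
    where
    identity : ∀ p → (p * suc p + p) * 4 ≡ (p + p) * (suc (p + p) + 3)
    identity = solve-∀
  columnCount-bound (even p) rewrite m+n∸n≡m (suc (suc p)) p | m+n∸n≡m (suc p) p =
    ≤/4 (≤-trans (m≤m+n _ 1) (≤-reflexive (identity p)))
    where
    identity : ∀ p → (p * suc (suc p) + suc p) * 4 + 1 ≡ suc (p + p) * (suc (suc (p + p)) + 3)
    identity = solve-∀

  module Multipartite {m n : ℕ} {part : Fin n → Fin m} {R : Rel (Fin n) 0ℓ} (mp : IsMPartite m n part R)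
    {B : ℕ} (pairDim : ∀ i j → i <ᶠ j → DimLE (InParts part i j) R B) where

    open IsMPartite mp using (isPartialOrder; antichain; upward)
    module R = IsPartialOrder isPartialOrder

    layer : Fin n → ℕ
    layer = toℕ ∘ part

    layer-mono : ∀ {x y} → R x y → layer x ≤ layer y
    layer-mono {x} {y} xy with x ≟ᶠ y
    ... | yes refl = ≤-refl
    ... | no x≢y   = <⇒≤ (upward x y xy x≢y)

    R? : ∀ x y → Dec (R x y)
    R? x y with <-cmp (part x) (part y) | x ≟ᶠ y
    ... | _                | yes refl = yes R.refl
    ... | tri< px<py _ _   | no _     with pairDim (part x) (part y) px<py
    ...   | _ , _ , _ , realizer = isRealizerOn-decidable realizer x y (inj₁ refl) (inj₂ refl)
    R? x y | tri≈ _ px≡py _ | no x≢y  = no (x≢y ∘ antichain x y px≡py)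
    R? x y | tri> _ _ px>py | no x≢y  = no (λ xy → <-irrefl refl (<-trans (upward x y xy x≢y) px>py))

    InLayers : ℕ → ℕ → Fin n → Set
    InLayers i j x = layer x ≡ i ⊎ layer x ≡ j

    module _ {i j : ℕ} (i<j : i < j) (j<m : j < m) where
      private
        X : Fin n → Set
        X = InParts part (fromℕ< (<-trans i<j j<m)) (fromℕ< j<m)

        toPart : ∀ {z t} (t<m : t < m) → layer z ≡ t → part z ≡ fromℕ< t<m
        toPart t<m e = toℕ-injective (trans e (sym (toℕ-fromℕ< t<m)))

        toParts : ∀ {z} → InLayers i j z → X z
        toParts (inj₁ e) = inj₁ (toPart (<-trans i<j j<m) e)
        toParts (inj₂ e) = inj₂ (toPart j<m e)

        dim : DimLE X R B
        dim = pairDim _ _ (subst₂ _<_ (sym (toℕ-fromℕ< _)) (sym (toℕ-fromℕ< _)) i<j)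

        X? : Decidable X
        X? x = (part x ≟ᶠ fromℕ< (<-trans i<j j<m)) ⊎-dec (part x ≟ᶠ fromℕ< j<m)

      layerPairExt : Fin B → PartialLinExt R
      layerPairExt = padded X? dim

      layerPairExt-reverses : ∀ {x y} → InLayers i j x → InLayers i j y → ¬ R x y
                            → ∃ λ k → Reverses (layerPairExt k) x y
      layerPairExt-reverses x∈ y∈ = padded-reverses X? dim (toParts x∈) (toParts y∈)

    -- Empty unless i < j < m: columns near the ends of the layer range name such pairs.
    pairExt : ℕ → ℕ → Fin B → PartialLinExt R
    pairExt i j with i <? j | j <? m
    ... | yes i<j | yes j<m = layerPairExt i<j j<m
    ... | _       | _       = λ _ → emptyLinExt

    pairExt-reverses : ∀ {i j} → i < j → j < m → ∀ {x y} → InLayers i j x → InLayers i j y → ¬ R x y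
                     → ∃ λ k → Reverses (pairExt i j k) x y
    pairExt-reverses {i} {j} i<j j<m with i <? j | j <? m
    ... | yes i<j′ | yes j<m′ = layerPairExt-reverses i<j′ j<m′
    ... | no i≮j   | _        = contradiction i<j i≮j
    ... | yes _    | no j≮m   = contradiction j<m j≮m

    pairAround : 1 < m → ∀ {l} → l < m → ∃₂ λ i j → i < j × j < m × (l ≡ i ⊎ l ≡ j)
    pairAround 1<m {zero}  _   = 0 , 1 , s≤s z≤n , 1<m , inj₁ refl
    pairAround _   {suc l} l<m = 0 , suc l , s≤s z≤n , l<m , inj₂ refl

    layers-cover : 1 < m → ∀ x y → ∃₂ λ i j → i < j × j < m × InLayers i j x × InLayers i j y
    layers-cover 1<m x y with <-cmp (part x) (part y)
    ... | tri< lx<ly _ _ = layer x , layer y , lx<ly , toℕ<n (part y) , inj₁ refl , inj₂ refl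
    ... | tri> _ _ ly<lx = layer y , layer x , ly<lx , toℕ<n (part x) , inj₂ refl , inj₁ refl
    ... | tri≈ _ px≡py _ with pairAround 1<m (toℕ<n (part x))
    ...   | i , j , i<j , j<m , x∈ = i , j , i<j , j<m , x∈ , subst (λ l → l ≡ i ⊎ l ≡ j) (cong toℕ px≡py) x∈

    columnPiece : ℕ → ℕ → Fin B → ℕ → PartialLinExt R
    columnPiece a b k 0 = pairExt (mirror m b) (pred a) k
    columnPiece a b k 1 = pairExt a b k
    columnPiece a b k 2 = pairExt (suc b) (mirror m a) k
    columnPiece a b k (suc (suc (suc _))) = emptyLinExt

    module Column (a b : ℕ) (k : Fin B) = Gluing isPartialOrder R? layer (upward _ _)
      (zone a b ∘ layer) (zone-mono a b ∘ layer-mono)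
      (λ c x → support (columnPiece a b k c) x × zone a b (layer x) ≡ c)
      (λ c x → support? (columnPiece a b k c) x ×-dec (zone a b (layer x) ≟ℕ c)) proj₂
      (order ∘ columnPiece a b k) (λ c → isLinExtOn-restrict (isLinExtOn (columnPiece a b k c)) (λ _ → proj₁))

    column : ℕ → ℕ → Fin B → Rel (Fin n) 0ℓ
    column = Column.glued

    column-isLinExtOn : ∀ a b k → IsLinExtOn (λ _ → ⊤) R (column a b k)
    column-isLinExtOn a b k = Column.glued-isLinExtOn a b k

    Serves : ℕ → ℕ → ℕ → ℕ → ℕ → Set₁
    Serves a b c i j = zone a b i ≡ c × zone a b j ≡ c × ∀ k → columnPiece a b k c ≡ pairExt i j k

    column-reverses : ∀ {a b c i j} → Serves a b c i j → ∀ {k x y} → InLayers i j x → InLayers i j y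
                    → Reverses (pairExt i j k) x y → column a b k y x
    column-reverses {a} {b} {c} {i} {j} (zi , zj , piece) {k} x∈ y∈ rev
      with sx , sy , yx ← subst (λ E → Reverses E _ _) (sym (piece k)) rev =
      Column.glued-extends a b k c (sy , inZone y∈) (sx , inZone x∈) yx
      where
      inZone : ∀ {z} → InLayers i j z → zone a b (layer z) ≡ c
      inZone (inj₁ refl) = zi
      inZone (inj₂ refl) = zj

    module _ (p : ℕ) (mid : IsMiddle m p) where

      Admissible : ℕ → ℕ → Set
      Admissible a b = a ≤ p × p ≤ b × b < m × a < b

      servingColumn : ∀ {i j} → i < j → j < m → ∃₂ λ a b → Admissible a b × ∃ λ c → Serves a b c i j
      servingColumn {i} {j} i<j j<m with j <? p | i ≤? p
      ... | yes j<p | _ = suc j , mirror m i , admissible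
                          , 0 , zone-low (<-trans i<j (n<1+n j)) (<⇒≤ (<-trans i<p p<b))
                              , zone-low (n<1+n j) (<⇒≤ (<-trans j<p p<b))
                              , λ k → cong (λ t → pairExt t j k) (mirror-involutive (<-trans i<j j<m))
        where
        i<p : i < p
        i<p = <-trans i<j j<p
        p<b : p < mirror m i
        p<b = p<mirror i<p (isMiddle⇒2p+1≤m mid)
        admissible : Admissible (suc j) (mirror m i)
        admissible = j<p , <⇒≤ p<b , mirror<m i (≤-<-trans z≤n j<m) , ≤-<-trans j<p p<b
      ... | no j≮p | yes i≤p = i , j , (i≤p , ≮⇒≥ j≮p , j<m , i<j)
                               , 1 , zone-middle ≤-refl (<⇒≤ i<j) , zone-middle (<⇒≤ i<j) ≤-refl , λ _ → refl
      ... | no _   | no i≰p = mirror m j , pred i , admissible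
                              , 2 , zone-high (<⇒≤ (<-trans a<p p<i)) pred-i<i
                                  , zone-high (<⇒≤ (<-trans a<p (<-trans p<i i<j))) (<-trans pred-i<i i<j)
                                  , λ k → cong₂ (λ s t → pairExt s t k) suc-pred-i (mirror-involutive j<m)
        where
        p<i : p < i
        p<i = ≰⇒> i≰p
        p≤pred-i : p ≤ pred i
        p≤pred-i = <⇒≤pred p<i
        a<p : mirror m j < p
        a<p = mirror<p (≤-trans (s≤s p<i) i<j) j<m (isMiddle⇒m≤2p+2 mid)
        suc-pred-i : suc (pred i) ≡ i
        suc-pred-i = suc-pred i {{>-nonZero (≤-<-trans z≤n p<i)}}
        pred-i<i : pred i < i
        pred-i<i = subst (pred i <_) suc-pred-i (n<1+n (pred i))
        admissible : Admissible (mirror m j) (pred i)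
        admissible = <⇒≤ a<p , p≤pred-i , ≤-<-trans pred[n]≤n (<-trans i<j j<m) , <-≤-trans a<p p≤pred-i

      decodeBelow : Fin p × Fin (m ∸ p) → ℕ × ℕ
      decodeBelow (a , b′) = toℕ a , p + toℕ b′

      decodeAt : Fin (m ∸ suc p) → ℕ × ℕ
      decodeAt b′ = p , suc p + toℕ b′

      columnOf : Fin (columnCount m p) → ℕ × ℕ
      columnOf = [ decodeBelow ∘ remQuot (m ∸ p) , decodeAt ]′ ∘ splitAt (p * (m ∸ p))

      columnOf-surjective : ∀ {a b} → Admissible a b → ∃ λ c → columnOf c ≡ (a , b)
      columnOf-surjective {a} {b} (a≤p , p≤b , b<m , a<b) with a <? p
      ... | yes a<p = combine a′ b′ ↑ˡ (m ∸ suc p) , (begin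
        columnOf (combine a′ b′ ↑ˡ (m ∸ suc p))
          ≡⟨ cong [ decodeBelow ∘ remQuot (m ∸ p) , decodeAt ]′ (splitAt-↑ˡ _ (combine a′ b′) _) ⟩
        decodeBelow (remQuot (m ∸ p) (combine a′ b′)) ≡⟨ cong decodeBelow (remQuot-combine a′ b′) ⟩
        (toℕ a′ , p + toℕ b′)
          ≡⟨ cong₂ (λ s t → s , p + t) (toℕ-fromℕ< a<p) (toℕ-fromℕ< b∸p<m∸p) ⟩
        (a , p + (b ∸ p))                             ≡⟨ cong (a ,_) (m+[n∸m]≡n p≤b) ⟩
        (a , b)                                       ∎)
        where
        b∸p<m∸p : b ∸ p < m ∸ p
        b∸p<m∸p = ∸-monoˡ-< b<m p≤b
        a′ : Fin p
        a′ = fromℕ< a<p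
        b′ : Fin (m ∸ p)
        b′ = fromℕ< b∸p<m∸p
      ... | no a≮p with ≤∧≮⇒≡ a≤p a≮p
      ...   | refl = (p * (m ∸ p)) ↑ʳ b′ , (begin
        columnOf ((p * (m ∸ p)) ↑ʳ b′)
          ≡⟨ cong [ decodeBelow ∘ remQuot (m ∸ p) , decodeAt ]′ (splitAt-↑ʳ _ _ b′) ⟩
        (p , suc p + toℕ b′)        ≡⟨ cong (λ t → p , suc p + t) (toℕ-fromℕ< b∸p<m∸p) ⟩
        (p , suc p + (b ∸ suc p))   ≡⟨ cong (p ,_) (m+[n∸m]≡n a<b) ⟩
        (p , b)                     ∎)
        where
        b∸p<m∸p : b ∸ suc p < m ∸ suc p
        b∸p<m∸p = ∸-monoˡ-< b<m a<b
        b′ : Fin (m ∸ suc p)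
        b′ = fromℕ< b∸p<m∸p

      columnAt : Fin (columnCount m p) × Fin B → Rel (Fin n) 0ℓ
      columnAt (c , k) = column (proj₁ (columnOf c)) (proj₂ (columnOf c)) k

      columns : Fin (columnCount m p * B) → Rel (Fin n) 0ℓ
      columns = columnAt ∘ remQuot B

      columns-isRealizer : 1 < m → IsRealizerOn (λ _ → ⊤) R (columnCount m p * B) columns
      columns-isRealizer 1<m = isRealizerOn-fromReversals (λ _ _ → R.refl) R? (λ _ → column-isLinExtOn _ _ _) reverse
        where
        reverse : ∀ x y → ⊤ → ⊤ → ¬ R x y → ∃ λ idx → columns idx y x
        reverse x y _ _ ¬xy with layers-cover 1<m x y
        ... | i , j , i<j , j<m , x∈ , y∈ with servingColumn i<j j<m | pairExt-reverses i<j j<m x∈ y∈ ¬xy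
        ... | a , b , admissible , _ , serves | k , rev with columnOf-surjective admissible
        ... | c , decodes = combine c k , subst (λ ck → columnAt ck y x) (sym (remQuot-combine c k))
                              (subst (λ ab → column (proj₁ ab) (proj₂ ab) k y x) (sym decodes)
                                     (column-reverses serves x∈ y∈ rev))

open import Defs
open import Level using (0ℓ)
open import Data.Nat using (ℕ; _≤_; _*_; _∸_; _+_; _/_)
open import Data.Fin using (Fin; _<_)
open import Data.Unit using (⊤)
open import Relation.Binary.Core using (Rel)
open import Data.Nat.Properties using (<⇒≤; *-monoˡ-≤)
open import Data.Product using (_,_)
open MultipartiteDimension using (middle; columnCount; columnCount-bound; module Multipartite)

theorem1 : (m : ℕ) → 2 ≤ m → (n : ℕ) → (part : Fin n → Fin m) → (R : Rel (Fin n) 0ℓ)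
    → IsMPartite m n part R
    → (B : ℕ) → (∀ (i j : Fin m) → i < j → DimLE (InParts part i j) R B)
    → DimLE (λ _ → ⊤) R (((m ∸ 1) * (m + 3)) / 4 * B)
theorem1 m 2≤m n part R mp B pairDim with middle m (<⇒≤ 2≤m)
... | p , mid = columnCount m p * B , *-monoˡ-≤ B (columnCount-bound mid)
              , columns p mid , columns-isRealizer p mid 2≤m
  where open Multipartite mp pairDim
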